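{- Let $G=(V,E)$ be a graph containing exactly $k$ triangles, and let $m$ denote the number of vertices of $G$ that do not lie on any triangle. Then the $\Delta$-Helly number satisfies $h_\Delta(G)\leq m+2k$.
   Context: All graphs are finite, simple, undirected and connected. A triangle is a set of three pairwise adjacent vertices (a copy of $K_3$). For $S\subseteq V$, the $\Delta$-interval $[S]$ is the set consisting of all vertices of $S$ together with every vertex $v\in V$ that is adjacent to both $x$ and $y$ for some pair of adjacent vertices $x,y\in S$. A set $S$ is $\Delta$-convex if $[S]=S$. The $\Delta$-convex hull $\langle S\rangle$ is the smallest $\Delta$-convex set containing $S$ (note $\langle\emptyset\rangle=\emptyset$). A set $S\subseteq V$ is Helly dependent if $\bigcap_{a\in S}\langle S\setminus\{a\}\rangle\neq\emptyset$, and Helly independent otherwise. The Helly number $h_\Delta(G)$ is the least integer $n\ge 0$ such that every $S\subseteq V$ with $|S|>n$ is Helly dependent (equivalently, the maximum size of a Helly independent set). -}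

module Defs where

open import Data.Nat using (ℕ; _+_; _*_; _<ᵇ_)
open import Data.Bool using (Bool; true; false; _∧_; not)
open import Data.Fin using (Fin; toℕ)
open import Data.Fin.Subset using (Subset; _∈_; _⊆_; _∩_; ∁; ⁅_⁆)
open import Data.List using (List; length; filterᵇ; allFin; concatMap; map)
open import Data.Bool.ListAction using (any)
open import Data.Empty using (⊥)
open import Data.Product using (_×_; _,_; ∃)
open import Relation.Binary.PropositionalEquality using (_≡_)

data Reach {n : ℕ} (adj : Fin n → Fin n → Bool) : Fin n → Fin n → Set where
  here : ∀ {u} → Reach adj u u
  step : ∀ {u w v} → adj u w ≡ true → Reach adj w v → Reach adj u v

record Graph : Set where
  field
    n         : ℕ
    adj       : Fin n → Fin n → Bool
    symmetric : ∀ x y → adj x y ≡ adj y x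
    irrefl    : ∀ x → adj x x ≡ false
    connected : ∀ x y → Reach adj x y
open Graph public

module _ (G : Graph) where
  private
    V = Fin (n G)
    _~_ : V → V → Bool
    x ~ y = adj G x y

  ΔConvex : Subset (n G) → Set
  ΔConvex T = ∀ x y v → x ∈ T → y ∈ T → x ~ y ≡ true
              → x ~ v ≡ true → y ~ v ≡ true → v ∈ T

  InHull : Subset (n G) → V → Set
  InHull S v = ∀ (T : Subset (n G)) → S ⊆ T → ΔConvex T → v ∈ T

  _∖_ : Subset (n G) → V → Subset (n G)
  S ∖ a = S ∩ ∁ ⁅ a ⁆

  HellyDependent : Subset (n G) → Set
  HellyDependent S = ∃ λ v → ∀ a → a ∈ S → InHull (S ∖ a) v

  HellyIndependent : Subset (n G) → Set
  HellyIndependent S = HellyDependent S → ⊥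

  triples : List (V × V × V)
  triples = concatMap (λ i → concatMap (λ j → map (λ l → i , j , l) (allFin (n G))) (allFin (n G))) (allFin (n G))

  -- (i,j,l) is a triangle listed with i < j < l (each triangle counted once)
  isTriangleᵇ : V × V × V → Bool
  isTriangleᵇ (i , j , l) = (toℕ i <ᵇ toℕ j) ∧ (toℕ j <ᵇ toℕ l) ∧ (i ~ j) ∧ (j ~ l) ∧ (i ~ l)

  numTriangles : ℕ
  numTriangles = length (filterᵇ isTriangleᵇ triples)

  onTriangleᵇ : V → Bool
  onTriangleᵇ v = any (λ { (i , j , l) → isTriangleᵇ (i , j , l) ∧ onIt i j l }) triples
    where
    open import Data.Fin using (_≟_)
    open import Relation.Nullary.Decidable using (⌊_⌋)
    open import Data.Bool using (_∨_)
    onIt : V → V → V → Bool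
    onIt i j l = ⌊ v ≟ i ⌋ ∨ ⌊ v ≟ j ⌋ ∨ ⌊ v ≟ l ⌋

  numOffTriangle : ℕ
  numOffTriangle = length (filterᵇ (λ v → not (onTriangleᵇ v)) (allFin (n G)))

-- If a triangle xyz lies inside S, then z is in every hull ⟨S ∖ a⟩: for a ≠ z trivially,
-- and for a = z because x, y ∈ S ∖ z are adjacent with common neighbour z. So a Helly
-- independent S meets every triangle in at most two vertices. Charging each vertex of S
-- to itself if it lies on no triangle, and to every triangle through it otherwise,
-- charges each triangle at most twice: |S| ≤ m + 2k.
module Submission where

open import Defs
open import Data.Nat using (ℕ; zero; suc; _+_; _*_; _≤_; z≤n; s≤s; _<ᵇ_)
open import Data.Nat.Properties
  using (≤-refl; ≤-trans; ≤-reflexive; +-mono-≤; +-commutativeSemigroup; *-identityˡ;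
         +-identityʳ; *-distribʳ-+; *-monoˡ-≤; *-comm; m≤m+n; m≤n+m; module ≤-Reasoning)
open import Algebra.Properties.CommutativeSemigroup +-commutativeSemigroup
  using () renaming (interchange to +-interchange)
open import Data.Bool using (Bool; true; false; T; _∧_; _∨_; not)
open import Data.Bool.Properties using (T-≡)
open import Data.Fin using (Fin; _≟_; toℕ)
open import Data.Fin.Subset using (Subset; ∣_∣; _∈_)
open import Data.Fin.Subset.Properties using (x∈p∩q⁺; x∉p⇒x∈∁p; x≢y⇒x∉⁅y⁆)
open import Data.List using (List; []; _∷_; length; filterᵇ; allFin; tabulate)
open import Data.List.Relation.Unary.Any using (Any; here; there)
open import Data.List.Relation.Unary.Any.Properties using (any⁻)
open import Data.Vec using (lookup) renaming (_∷_ to _∷ᵥ_; [] to []ᵥ)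
open import Data.Vec.Properties using (lookup⇒[]=)
open import Data.Product using (_×_; _,_)
open import Data.Empty using (⊥-elim)
open import Function using (_∘_; Equivalence)
open import Relation.Nullary using (¬_; yes; no)
open import Relation.Nullary.Decidable using (⌊_⌋)
open import Relation.Binary.PropositionalEquality using (_≡_; _≢_; refl; sym; trans; cong; cong₂)

open Equivalence using (to; from)

χ : Bool → ℕ
χ true  = 1
χ false = 0

χ≤1 : ∀ b → χ b ≤ 1
χ≤1 true  = ≤-refl
χ≤1 false = z≤n

χ-∨∨ : ∀ a b c → χ (a ∨ b ∨ c) ≤ χ a + (χ b + χ c)
χ-∨∨ true  b     c     = s≤s z≤n
χ-∨∨ false true  c     = s≤s z≤n
χ-∨∨ false false true  = s≤s z≤n
χ-∨∨ false false false = z≤n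

T-∧⁻ : ∀ a {b} → T (a ∧ b) → T a × T b
T-∧⁻ true t = _ , t

χ+χ+χ≤2 : ∀ a b c → ¬ T (a ∧ b ∧ c) → χ a + (χ b + χ c) ≤ 2
χ+χ+χ≤2 true  true  true  all = ⊥-elim (all _)
χ+χ+χ≤2 true  true  false _   = ≤-refl
χ+χ+χ≤2 true  false c     _   = s≤s (χ≤1 c)
χ+χ+χ≤2 false b     c     _   = +-mono-≤ (χ≤1 b) (χ≤1 c)

module _ {A : Set} where

  ∑ : List A → (A → ℕ) → ℕ
  ∑ []       f = 0
  ∑ (x ∷ xs) f = f x + ∑ xs f

  ∑-zero : ∀ xs → ∑ xs (λ _ → 0) ≡ 0
  ∑-zero []       = refl
  ∑-zero (x ∷ xs) = ∑-zero xs

  ∑-cong : ∀ xs {f g : A → ℕ} → (∀ x → f x ≡ g x) → ∑ xs f ≡ ∑ xs g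
  ∑-cong []       f≡g = refl
  ∑-cong (x ∷ xs) f≡g = cong₂ _+_ (f≡g x) (∑-cong xs f≡g)

  ∑-mono-≤ : ∀ xs {f g : A → ℕ} → (∀ x → f x ≤ g x) → ∑ xs f ≤ ∑ xs g
  ∑-mono-≤ []       f≤g = z≤n
  ∑-mono-≤ (x ∷ xs) f≤g = +-mono-≤ (f≤g x) (∑-mono-≤ xs f≤g)

  ∑-distrib-+ : ∀ xs (f g : A → ℕ) → ∑ xs (λ x → f x + g x) ≡ ∑ xs f + ∑ xs g
  ∑-distrib-+ []       f g = refl
  ∑-distrib-+ (x ∷ xs) f g =
    trans (cong (f x + g x +_) (∑-distrib-+ xs f g)) (+-interchange (f x) (g x) (∑ xs f) (∑ xs g))

  ∑-distribʳ-* : ∀ xs (f : A → ℕ) c → ∑ xs f * c ≡ ∑ xs (λ x → f x * c)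
  ∑-distribʳ-* []       f c = refl
  ∑-distribʳ-* (x ∷ xs) f c =
    trans (*-distribʳ-+ c (f x) (∑ xs f)) (cong (f x * c +_) (∑-distribʳ-* xs f c))

  length-filterᵇ : ∀ (p : A → Bool) xs → length (filterᵇ p xs) ≡ ∑ xs (χ ∘ p)
  length-filterᵇ p []       = refl
  length-filterᵇ p (x ∷ xs) with p x
  ... | true  = cong suc (length-filterᵇ p xs)
  ... | false = length-filterᵇ p xs

  Any⇒1≤∑ : ∀ {P : A → Set} {xs} (h : A → ℕ) → (∀ {x} → P x → 1 ≤ h x) → Any P xs → 1 ≤ ∑ xs h
  Any⇒1≤∑ h 1≤h (here {x} px)   = ≤-trans (1≤h px) (m≤m+n (h x) _)
  Any⇒1≤∑ h 1≤h (there {x} pxs) = ≤-trans (Any⇒1≤∑ h 1≤h pxs) (m≤n+m _ (h x))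

∑-comm : ∀ {A B : Set} (xs : List A) (ys : List B) (f : A → B → ℕ) →
         ∑ xs (λ x → ∑ ys (f x)) ≡ ∑ ys (λ y → ∑ xs (λ x → f x y))
∑-comm []       ys f = sym (∑-zero ys)
∑-comm (x ∷ xs) ys f =
  trans (cong (∑ ys (f x) +_) (∑-comm xs ys f)) (sym (∑-distrib-+ ys (f x) _))

∑-tabulate : ∀ {A : Set} n (g : Fin n → A) (h : A → ℕ) → ∑ (tabulate g) h ≡ ∑ (allFin n) (h ∘ g)
∑-tabulate zero    g h = refl
∑-tabulate (suc n) g h = cong (h (g Fin.zero) +_)
  (trans (∑-tabulate n (g ∘ Fin.suc) h) (sym (∑-tabulate n Fin.suc (h ∘ g))))

∑-allFin-suc : ∀ n (f : Fin (suc n) → ℕ) → ∑ (allFin (suc n)) f ≡ f Fin.zero + ∑ (allFin n) (f ∘ Fin.suc)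
∑-allFin-suc n f = cong (f Fin.zero +_) (∑-tabulate n Fin.suc f)

∑-allFin-point : ∀ n (i : Fin n) (f : Fin n → ℕ) → ∑ (allFin n) (λ v → χ ⌊ v ≟ i ⌋ * f v) ≡ f i
∑-allFin-point (suc n) Fin.zero f = begin
  ∑ (allFin (suc n)) (λ v → χ ⌊ v ≟ Fin.zero ⌋ * f v) ≡⟨ ∑-allFin-suc n (λ v → χ ⌊ v ≟ Fin.zero ⌋ * f v) ⟩
  1 * f Fin.zero + ∑ (allFin n) (λ _ → 0)             ≡⟨ cong₂ _+_ (*-identityˡ _) (∑-zero (allFin n)) ⟩
  f Fin.zero + 0                                      ≡⟨ +-identityʳ _ ⟩
  f Fin.zero                                          ∎
  where open Relation.Binary.PropositionalEquality.≡-Reasoning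
∑-allFin-point (suc n) (Fin.suc i) f = begin
  ∑ (allFin (suc n)) (λ v → χ ⌊ v ≟ Fin.suc i ⌋ * f v)
    ≡⟨ ∑-allFin-suc n (λ v → χ ⌊ v ≟ Fin.suc i ⌋ * f v) ⟩
  ∑ (allFin n) (λ v → χ ⌊ Fin.suc v ≟ Fin.suc i ⌋ * f (Fin.suc v))
    ≡⟨ ∑-cong (allFin n) (λ v → cong (λ b → χ b * f (Fin.suc v)) (⌊suc≟suc⌋ v i)) ⟩
  ∑ (allFin n) (λ v → χ ⌊ v ≟ i ⌋ * f (Fin.suc v))
    ≡⟨ ∑-allFin-point n i (λ v → f (Fin.suc v)) ⟩
  f (Fin.suc i) ∎
  where
  open Relation.Binary.PropositionalEquality.≡-Reasoning
  ⌊suc≟suc⌋ : ∀ {m} (v i : Fin m) → ⌊ Fin.suc v ≟ Fin.suc i ⌋ ≡ ⌊ v ≟ i ⌋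
  ⌊suc≟suc⌋ v i with v ≟ i
  ... | yes _ = refl
  ... | no  _ = refl

∣p∣≡∑χ : ∀ {n} (p : Subset n) → ∣ p ∣ ≡ ∑ (allFin n) (χ ∘ lookup p)
∣p∣≡∑χ []ᵥ               = refl
∣p∣≡∑χ {suc n} (b ∷ᵥ p) = trans (∣b∷p∣ b) (sym (∑-allFin-suc n (χ ∘ lookup (b ∷ᵥ p))))
  where
  ∣b∷p∣ : ∀ b → ∣ b ∷ᵥ p ∣ ≡ χ b + ∑ (allFin n) (χ ∘ lookup p)
  ∣b∷p∣ true  = cong suc (∣p∣≡∑χ p)
  ∣b∷p∣ false = ∣p∣≡∑χ p

module _ (G : Graph) where
  private
    V = Fin (n G)
    _~_ : V → V → Bool
    x ~ y = adj G x y
    Vs = allFin (n G)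

  adj⇒≢ : ∀ {x y} → T (x ~ y) → x ≢ y
  adj⇒≢ {x} x~x refl with x ~ x | irrefl G x
  ... | false | _ = x~x

  triangle⇒adj : ∀ {i j l} → T (isTriangleᵇ G (i , j , l)) → T (i ~ j) × T (j ~ l) × T (i ~ l)
  triangle⇒adj {i} {j} {l} t with T-∧⁻ (toℕ i <ᵇ toℕ j) t
  ... | _ , t′ with T-∧⁻ (toℕ j <ᵇ toℕ l) t′
  ... | _ , t″ with T-∧⁻ (i ~ j) t″
  ... | ij , t‴ = ij , T-∧⁻ (j ~ l) t‴

  ∈∖ : ∀ {S : Subset (n G)} {x a} → x ∈ S → x ≢ a → x ∈ _∖_ G S a
  ∈∖ x∈S x≢a = x∈p∩q⁺ (x∈S , x∉p⇒x∈∁p (x≢y⇒x∉⁅y⁆ x≢a))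

  triangle⇒HellyDependent : ∀ {S x y z} → x ∈ S → y ∈ S → z ∈ S →
                            T (x ~ y) → T (x ~ z) → T (y ~ z) → HellyDependent G S
  triangle⇒HellyDependent {S} {x} {y} {z} x∈S y∈S z∈S xy xz yz = z , z∈hulls
    where
    z∈hulls : ∀ a → a ∈ S → InHull G (_∖_ G S a) z
    z∈hulls a _ T S∖a⊆T convex with z ≟ a
    ... | no  z≢a  = S∖a⊆T (∈∖ z∈S z≢a)
    ... | yes refl = convex x y z (S∖a⊆T (∈∖ x∈S (adj⇒≢ xz))) (S∖a⊆T (∈∖ y∈S (adj⇒≢ yz)))
                       (to T-≡ xy) (to T-≡ xz) (to T-≡ yz)

  NoTriangleIn : Subset (n G) → Set
  NoTriangleIn S = ∀ i j l → T (isTriangleᵇ G (i , j , l)) → ¬ T (lookup S i ∧ lookup S j ∧ lookup S l)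

  HellyIndependent⇒NoTriangleIn : ∀ {S} → HellyIndependent G S → NoTriangleIn S
  HellyIndependent⇒NoTriangleIn {S} indep i j l t inS with triangle⇒adj t | T-∧⁻ (lookup S i) inS
  ... | ij , jl , il | i∈ , jl∈ with T-∧⁻ (lookup S j) jl∈
  ... | j∈ , l∈ = indep (triangle⇒HellyDependent (member i∈) (member j∈) (member l∈) ij il jl)
    where
    member : ∀ {x} → T (lookup S x) → x ∈ S
    member {x} = lookup⇒[]= x S ∘ to T-≡

  incidentᵇ : V → V × V × V → Bool
  incidentᵇ v (i , j , l) = isTriangleᵇ G (i , j , l) ∧ (⌊ v ≟ i ⌋ ∨ ⌊ v ≟ j ⌋ ∨ ⌊ v ≟ l ⌋)

  onTriangle⇒1≤incidences : ∀ v → T (onTriangleᵇ G v) → 1 ≤ ∑ (triples G) (χ ∘ incidentᵇ v)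
  onTriangle⇒1≤incidences v onT =
    Any⇒1≤∑ (χ ∘ incidentᵇ v) (λ {t} → 1≤χ t) (any⁻ _ (triples G) onT)
    where
    1≤χ : ∀ t → T (incidentᵇ v t) → 1 ≤ χ (incidentᵇ v t)
    1≤χ t inc with incidentᵇ v t
    ... | true = ≤-refl

  module _ (S : Subset (n G)) where
    private
      s : V → ℕ
      s = χ ∘ lookup S

    member≤offTriangle+incidences : ∀ v →
      s v ≤ χ (not (onTriangleᵇ G v)) + ∑ (triples G) (χ ∘ incidentᵇ v) * s v
    member≤offTriangle+incidences v with onTriangleᵇ G v in onT
    ... | false = ≤-trans (χ≤1 (lookup S v)) (m≤m+n 1 _)
    ... | true  = begin
      s v                                           ≡⟨ sym (*-identityˡ (s v)) ⟩
      1 * s v                                       ≤⟨ *-monoˡ-≤ (s v) (onTriangle⇒1≤incidences v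
                                                         (from T-≡ onT)) ⟩
      ∑ (triples G) (χ ∘ incidentᵇ v) * s v         ∎
      where open ≤-Reasoning

    -- The incidence weight of (i , j , l), unfolded so that `with` can abstract the triangle test.
    triangleWeight≤2 : NoTriangleIn S → ∀ i j l →
      ∑ Vs (λ v → χ (isTriangleᵇ G (i , j , l) ∧ (⌊ v ≟ i ⌋ ∨ ⌊ v ≟ j ⌋ ∨ ⌊ v ≟ l ⌋)) * s v)
        ≤ χ (isTriangleᵇ G (i , j , l)) * 2
    triangleWeight≤2 noTri i j l with isTriangleᵇ G (i , j , l) in t
    ... | false = ≤-reflexive (∑-zero Vs)
    ... | true  = begin
      ∑ Vs (λ v → χ (⌊ v ≟ i ⌋ ∨ ⌊ v ≟ j ⌋ ∨ ⌊ v ≟ l ⌋) * s v)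
        ≤⟨ ∑-mono-≤ Vs (λ v → split ⌊ v ≟ i ⌋ ⌊ v ≟ j ⌋ ⌊ v ≟ l ⌋ (s v)) ⟩
      ∑ Vs (λ v → at i v + (at j v + at l v))
        ≡⟨ trans (∑-distrib-+ Vs (at i) _) (cong (∑ Vs (at i) +_) (∑-distrib-+ Vs (at j) (at l))) ⟩
      ∑ Vs (at i) + (∑ Vs (at j) + ∑ Vs (at l))
        ≡⟨ cong₂ _+_ (∑-allFin-point (n G) i s)
                     (cong₂ _+_ (∑-allFin-point (n G) j s) (∑-allFin-point (n G) l s)) ⟩
      s i + (s j + s l)
        ≤⟨ χ+χ+χ≤2 (lookup S i) (lookup S j) (lookup S l) (noTri i j l (from T-≡ t)) ⟩
      2 ∎
      where
      open ≤-Reasoning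
      at : V → V → ℕ
      at x v = χ ⌊ v ≟ x ⌋ * s v
      split : ∀ a b c k → χ (a ∨ b ∨ c) * k ≤ χ a * k + (χ b * k + χ c * k)
      split a b c k = ≤-trans (*-monoˡ-≤ k (χ-∨∨ a b c))
        (≤-reflexive (trans (*-distribʳ-+ k (χ a) _) (cong (χ a * k +_) (*-distribʳ-+ k (χ b) _))))

    NoTriangleIn⇒∣S∣≤ : NoTriangleIn S → ∣ S ∣ ≤ numOffTriangle G + 2 * numTriangles G
    NoTriangleIn⇒∣S∣≤ noTri = begin
      ∣ S ∣
        ≡⟨ ∣p∣≡∑χ S ⟩
      ∑ Vs s
        ≤⟨ ∑-mono-≤ Vs member≤offTriangle+incidences ⟩
      ∑ Vs (λ v → χ (not (onTriangleᵇ G v)) + ∑ (triples G) (χ ∘ incidentᵇ v) * s v)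
        ≡⟨ ∑-distrib-+ Vs _ _ ⟩
      ∑ Vs (λ v → χ (not (onTriangleᵇ G v))) + ∑ Vs (λ v → ∑ (triples G) (χ ∘ incidentᵇ v) * s v)
        ≡⟨ cong₂ _+_ (sym (length-filterᵇ _ Vs)) (∑-cong Vs (λ v → ∑-distribʳ-* (triples G) _ (s v))) ⟩
      numOffTriangle G + ∑ Vs (λ v → ∑ (triples G) (λ t → χ (incidentᵇ v t) * s v))
        ≡⟨ cong (numOffTriangle G +_) (∑-comm Vs (triples G) _) ⟩
      numOffTriangle G + ∑ (triples G) (λ t → ∑ Vs (λ v → χ (incidentᵇ v t) * s v))
        ≤⟨ +-mono-≤ (≤-refl {numOffTriangle G})
             (∑-mono-≤ (triples G) (λ { (i , j , l) → triangleWeight≤2 noTri i j l })) ⟩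
      numOffTriangle G + ∑ (triples G) (λ t → χ (isTriangleᵇ G t) * 2)
        ≡⟨ cong (numOffTriangle G +_) (sym (∑-distribʳ-* (triples G) _ 2)) ⟩
      numOffTriangle G + ∑ (triples G) (χ ∘ isTriangleᵇ G) * 2
        ≡⟨ cong (numOffTriangle G +_) (trans (cong (_* 2) (sym (length-filterᵇ _ (triples G))))
                                             (*-comm (numTriangles G) 2)) ⟩
      numOffTriangle G + 2 * numTriangles G ∎
      where open ≤-Reasoning

theorem2 : (G : Graph) → (S : Subset (n G)) → HellyIndependent G S
    → ∣ S ∣ ≤ numOffTriangle G + 2 * numTriangles G
theorem2 G S indep = NoTriangleIn⇒∣S∣≤ G S (HellyIndependent⇒NoTriangleIn G indep)
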